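{- Let $\mathcal D$ be a finite non-empty hereditarily finite set. For every formula $\varphi$ of $\mathrm{FSO}_{\mathcal D}$, the theory $\mathrm{FSO}^0_{\mathcal D}$ proves $$\forall x\big[\forall y\,(y<x\to\varphi(y))\to\varphi(x)\big]\ \longrightarrow\ \forall x\,\varphi(x).$$
   Context: Language of $\mathrm{FSO}_{\mathcal D}$: HF-terms $K::=k\mid\dot\kappa\mid\dot g_{n,m}(K_1,\dots,K_n)$ ($k$ HF-variables, $\kappa$ hereditarily finite sets, $(n,m)\in\mathbb N^2$); Individual terms $t::=x\mid\mathsf{Root}\mid\mathsf S_d(t)$ ($d\in\mathcal D$); Function variables $F$; formulas $t\doteq u,t<u,K\doteq L,K\in L,K\subseteq L,F(t)\doteq K$ closed under $\lor,\neg,\exists x,\exists F{:}K,\exists k\in L,\exists k\subseteq L$; $t\le u:=t<u\lor t\doteq u$; $(F{:}K):=\forall x\exists k\in K\,F(x)\doteq k$. $\mathrm{FSO}^0_{\mathcal D}$ consists of the deduction rules of FSO — classical propositional natural deduction (excluded middle, axiom, ex falso, $\lor$-introduction/elimination), rules for $\exists x$, $\exists F{:}K$ (introduction from $\varphi[G/F]$ and $(G{:}K)$; elimination with extra hypothesis $(F{:}K)$), bounded HF quantifiers $\exists k\lhd L$ (introduction needs $K\lhd L$, elimination adds $k\lhd K$), and the substitution rule from $\Phi\vdash\varphi$ to $\Phi[F(t)/k]\vdash\varphi[F(t)/k]$ — together with: equality axioms ($\forall x\,x\doteq x$, $\forall x\forall y(x\doteq y\to\varphi[x/z]\to\varphi[y/z])$,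 $K\doteq K$, $K\doteq L\to\varphi[K/m]\to\varphi[L/m]$); the induction scheme $\varphi(\mathsf{Root})\to\bigwedge_{d\in\mathcal D}\forall x(\varphi(x)\to\varphi(\mathsf S_d(x)))\to\forall x\varphi(x)$ for every formula; and the tree axioms $\neg\exists x\bigvee_{d\ne d'}\mathsf S_d(x)\doteq\mathsf S_{d'}(x)$, $\forall x\forall y\bigwedge_d(\mathsf S_d(x)\doteq\mathsf S_d(y)\to x\doteq y)$, $\neg\exists x\,x<x$, $\forall x\forall y\forall z(x<y\to y<z\to x<z)$, $\forall x\,\mathsf{Root}\le x$, $\forall x\forall y\bigwedge_d(x<\mathsf S_d(y)\leftrightarrow x\le y)$. -}

module Defs where

open import Data.Nat using (ℕ; zero; suc)
open import Data.Fin using (Fin; zero; suc; _≟_)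
open import Data.Vec using (Vec; []; _∷_)
open import Data.List using (List; []; _∷_; map; concatMap; allFin)
open import Data.List.Membership.Propositional using (_∈_)
open import Data.Product using (_×_; _,_)
open import Relation.Nullary using (yes; no)
open import Function using (id; _∘_)

-- Hereditarily finite sets (as finitely branching rose trees; used only
-- as names of HF-constants  κ̇ ).
data HF : Set where
  set : List HF → HF

_▸_ : ∀ {a} {A : Set a} {n} → A → (Fin n → A) → Fin (suc n) → A
(a ▸ σ) zero    = a
(a ▸ σ) (suc i) = σ i

-- The language FSO_D, for D a finite non-empty set of directions,
-- represented (up to bijection) as  Fin (suc m),  |D| = suc m.
-- Variables are de Bruijn indices, with three separate sorts:
-- ni individual, nh HF, nf function variables.
module FSO (m : ℕ) where

  Dir : Set
  Dir = Fin (suc m)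

  data HTm (nh : ℕ) : Set where
    hv : Fin nh → HTm nh
    hc : HF → HTm nh
    hg : (n k : ℕ) → Vec (HTm nh) n → HTm nh

  data Tm (ni : ℕ) : Set where
    iv   : Fin ni → Tm ni
    Root : Tm ni
    S    : Dir → Tm ni → Tm ni

  infix 7 _≐_ _≺_ _≐ₕ_ _∈ₕ_ _⊆ₕ_
  infixr 5 _∨_
  infix 6 ¬_

  data Form (ni nh nf : ℕ) : Set where
    _≐_  : Tm ni → Tm ni → Form ni nh nf
    _≺_  : Tm ni → Tm ni → Form ni nh nf
    _≐ₕ_ : HTm nh → HTm nh → Form ni nh nf
    _∈ₕ_ : HTm nh → HTm nh → Form ni nh nf
    _⊆ₕ_ : HTm nh → HTm nh → Form ni nh nf
    app≐ : Fin nf → Tm ni → HTm nh → Form ni nh nf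
    _∨_  : Form ni nh nf → Form ni nh nf → Form ni nh nf
    ¬_   : Form ni nh nf → Form ni nh nf
    ∃ᵢ   : Form (suc ni) nh nf → Form ni nh nf
    ∃F∶  : HTm nh → Form ni nh (suc nf) → Form ni nh nf
    ∃∈   : HTm nh → Form ni (suc nh) nf → Form ni nh nf
    ∃⊆   : HTm nh → Form ni (suc nh) nf → Form ni nh nf

  tsub : ∀ {ni ni'} → (Fin ni → Tm ni') → Tm ni → Tm ni'
  tsub σ (iv x)  = σ x
  tsub σ Root    = Root
  tsub σ (S d t) = S d (tsub σ t)

  mutual
    hsub : ∀ {nh nh'} → (Fin nh → HTm nh') → HTm nh → HTm nh'
    hsub σ (hv k)      = σ k
    hsub σ (hc κ)      = hc κ
    hsub σ (hg n k Ks) = hg n k (hsubs σ Ks)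

    hsubs : ∀ {nh nh' n} → (Fin nh → HTm nh') → Vec (HTm nh) n → Vec (HTm nh') n
    hsubs σ []       = []
    hsubs σ (K ∷ Ks) = hsub σ K ∷ hsubs σ Ks

  liftI : ∀ {ni ni'} → (Fin ni → Tm ni') → Fin (suc ni) → Tm (suc ni')
  liftI σ = iv zero ▸ (tsub (iv ∘ suc) ∘ σ)

  liftH : ∀ {nh nh'} → (Fin nh → HTm nh') → Fin (suc nh) → HTm (suc nh')
  liftH σ = hv zero ▸ (hsub (hv ∘ suc) ∘ σ)

  liftF : ∀ {nf nf'} → (Fin nf → Fin nf') → Fin (suc nf) → Fin (suc nf')
  liftF ρ = zero ▸ (suc ∘ ρ)

  sub : ∀ {ni nh nf ni' nh' nf'} →
        (Fin ni → Tm ni') → (Fin nh → HTm nh') → (Fin nf → Fin nf') →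
        Form ni nh nf → Form ni' nh' nf'
  sub σ τ ρ (t ≐ u)     = tsub σ t ≐ tsub σ u
  sub σ τ ρ (t ≺ u)     = tsub σ t ≺ tsub σ u
  sub σ τ ρ (K ≐ₕ L)    = hsub τ K ≐ₕ hsub τ L
  sub σ τ ρ (K ∈ₕ L)    = hsub τ K ∈ₕ hsub τ L
  sub σ τ ρ (K ⊆ₕ L)    = hsub τ K ⊆ₕ hsub τ L
  sub σ τ ρ (app≐ F t K) = app≐ (ρ F) (tsub σ t) (hsub τ K)
  sub σ τ ρ (φ ∨ ψ)     = sub σ τ ρ φ ∨ sub σ τ ρ ψ
  sub σ τ ρ (¬ φ)       = ¬ sub σ τ ρ φ
  sub σ τ ρ (∃ᵢ φ)      = ∃ᵢ (sub (liftI σ) τ ρ φ)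
  sub σ τ ρ (∃F∶ K φ)   = ∃F∶ (hsub τ K) (sub σ τ (liftF ρ) φ)
  sub σ τ ρ (∃∈ L φ)    = ∃∈ (hsub τ L) (sub σ (liftH τ) ρ φ)
  sub σ τ ρ (∃⊆ L φ)    = ∃⊆ (hsub τ L) (sub σ (liftH τ) ρ φ)

  wkI : ∀ {ni nh nf} → Form ni nh nf → Form (suc ni) nh nf
  wkI = sub (iv ∘ suc) hv id

  wkH : ∀ {ni nh nf} → Form ni nh nf → Form ni (suc nh) nf
  wkH = sub iv (hv ∘ suc) id

  wkF : ∀ {ni nh nf} → Form ni nh nf → Form ni nh (suc nf)
  wkF = sub iv hv suc

  hwk : ∀ {nh} → HTm nh → HTm (suc nh)
  hwk = hsub (hv ∘ suc)

  _[_]ᵢ : ∀ {ni nh nf} → Form (suc ni) nh nf → Tm ni → Form ni nh nf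
  φ [ t ]ᵢ = sub (t ▸ iv) hv id φ

  _[_]ₕ : ∀ {ni nh nf} → Form ni (suc nh) nf → HTm nh → Form ni nh nf
  φ [ K ]ₕ = sub iv (K ▸ hv) id φ

  _[_]f : ∀ {ni nh nf} → Form ni nh (suc nf) → Fin nf → Form ni nh nf
  φ [ G ]f = sub iv hv (G ▸ id) φ

  infixr 4 _⇒_
  infixr 4 _⇔_
  infixr 5 _∧_

  _⇒_ : ∀ {ni nh nf} → Form ni nh nf → Form ni nh nf → Form ni nh nf
  φ ⇒ ψ = ¬ φ ∨ ψ

  _∧_ : ∀ {ni nh nf} → Form ni nh nf → Form ni nh nf → Form ni nh nf
  φ ∧ ψ = ¬ (¬ φ ∨ ¬ ψ)

  _⇔_ : ∀ {ni nh nf} → Form ni nh nf → Form ni nh nf → Form ni nh nf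
  φ ⇔ ψ = (φ ⇒ ψ) ∧ (ψ ⇒ φ)

  ∀ᵢ : ∀ {ni nh nf} → Form (suc ni) nh nf → Form ni nh nf
  ∀ᵢ φ = ¬ ∃ᵢ (¬ φ)

  _≼_ : ∀ {ni nh nf} → Tm ni → Tm ni → Form ni nh nf
  t ≼ u = (t ≺ u) ∨ (t ≐ u)

  _∶_ : ∀ {ni nh nf} → Fin nf → HTm nh → Form ni nh nf
  F ∶ K = ∀ᵢ (∃∈ K (app≐ F (iv zero) (hv zero)))

  ⊥f : ∀ {ni nh nf} → Form ni nh nf
  ⊥f = ¬ (Root ≐ Root)

  ⊤f : ∀ {ni nh nf} → Form ni nh nf
  ⊤f = Root ≐ Root

  ⋁ : ∀ {ni nh nf} → List (Form ni nh nf) → Form ni nh nf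
  ⋁ []           = ⊥f
  ⋁ (φ ∷ [])     = φ
  ⋁ (φ ∷ ψ ∷ ψs) = φ ∨ ⋁ (ψ ∷ ψs)

  ⋀ : ∀ {ni nh nf} → List (Form ni nh nf) → Form ni nh nf
  ⋀ []           = ⊤f
  ⋀ (φ ∷ [])     = φ
  ⋀ (φ ∷ ψ ∷ ψs) = φ ∧ ⋀ (ψ ∷ ψs)

  dirs : List Dir
  dirs = allFin (suc m)

  distinctPairs : List (Dir × Dir)
  distinctPairs = concatMap (λ d → concatMap (λ d' → pick d d') dirs) dirs
    where
      pick : Dir → Dir → List (Dir × Dir)
      pick d d' with d ≟ d'
      ... | yes _ = []
      ... | no  _ = (d , d') ∷ []

  x0 : ∀ {ni} → Tm (suc ni)
  x0 = iv zero
  x1 : ∀ {ni} → Tm (suc (suc ni))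
  x1 = iv (suc zero)
  x2 : ∀ {ni} → Tm (suc (suc (suc ni)))
  x2 = iv (suc (suc zero))

  sh1 : ∀ {ni} → Fin ni → Tm (suc ni)
  sh1 i = iv (suc i)

  sh2 : ∀ {ni} → Fin ni → Tm (suc (suc ni))
  sh2 i = iv (suc (suc i))

  data Axiom {ni nh nf : ℕ} : Form ni nh nf → Set where
    eqRefl  : Axiom (∀ᵢ (x0 ≐ x0))
    eqLeib  : (φ : Form (suc ni) nh nf) →
              Axiom (∀ᵢ (∀ᵢ ((x1 ≐ x0) ⇒
                     sub (x1 ▸ sh2) hv id φ ⇒
                     sub (x0 ▸ sh2) hv id φ)))
    heqRefl : (K : HTm nh) → Axiom (K ≐ₕ K)
    heqLeib : (K L : HTm nh) (φ : Form ni (suc nh) nf) →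
              Axiom ((K ≐ₕ L) ⇒ φ [ K ]ₕ ⇒ φ [ L ]ₕ)
    induction : (φ : Form (suc ni) nh nf) →
              Axiom (φ [ Root ]ᵢ ⇒
                     ⋀ (map (λ d → ∀ᵢ (φ ⇒ sub (S d x0 ▸ sh1) hv id φ)) dirs) ⇒
                     ∀ᵢ φ)
    tree1 : Axiom (¬ ∃ᵢ (⋁ (map (λ { (d , d') → S d x0 ≐ S d' x0 }) distinctPairs)))
    tree2 : Axiom (∀ᵢ (∀ᵢ (⋀ (map (λ d → (S d x1 ≐ S d x0) ⇒ (x1 ≐ x0)) dirs))))
    tree3 : Axiom (¬ ∃ᵢ (x0 ≺ x0))
    tree4 : Axiom (∀ᵢ (∀ᵢ (∀ᵢ ((x2 ≺ x1) ⇒ (x1 ≺ x0) ⇒ (x2 ≺ x0)))))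
    tree5 : Axiom (∀ᵢ (Root ≼ x0))
    tree6 : Axiom (∀ᵢ (∀ᵢ (⋀ (map (λ d → (x1 ≺ S d x0) ⇔ (x1 ≼ x0)) dirs))))

  infix 2 _⊢_

  data _⊢_ {ni nh nf : ℕ} : List (Form ni nh nf) → Form ni nh nf → Set where
    exm    : ∀ {Φ φ} → Φ ⊢ φ ∨ ¬ φ
    ass    : ∀ {Φ φ} → φ ∈ Φ → Φ ⊢ φ
    exfalso : ∀ {Φ φ ψ} → Φ ⊢ φ → Φ ⊢ ¬ φ → Φ ⊢ ψ
    ∨Iˡ    : ∀ {Φ φ ψ} → Φ ⊢ φ → Φ ⊢ φ ∨ ψ
    ∨Iʳ    : ∀ {Φ φ ψ} → Φ ⊢ ψ → Φ ⊢ φ ∨ ψ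
    ∨E     : ∀ {Φ φ ψ χ} → Φ ⊢ φ ∨ ψ → (φ ∷ Φ) ⊢ χ → (ψ ∷ Φ) ⊢ χ → Φ ⊢ χ
    ∃ᵢI    : ∀ {Φ φ} (t : Tm ni) → Φ ⊢ φ [ t ]ᵢ → Φ ⊢ ∃ᵢ φ
    ∃ᵢE    : ∀ {Φ φ ψ} → Φ ⊢ ∃ᵢ φ → (φ ∷ map wkI Φ) ⊢ wkI ψ → Φ ⊢ ψ
    ∃FI    : ∀ {Φ K φ} (G : Fin nf) → Φ ⊢ φ [ G ]f → Φ ⊢ (G ∶ K) → Φ ⊢ ∃F∶ K φ
    ∃FE    : ∀ {Φ K φ ψ} → Φ ⊢ ∃F∶ K φ →
             (φ ∷ (zero ∶ K) ∷ map wkF Φ) ⊢ wkF ψ → Φ ⊢ ψ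
    ∃∈I    : ∀ {Φ L φ} (K : HTm nh) → Φ ⊢ φ [ K ]ₕ → Φ ⊢ (K ∈ₕ L) → Φ ⊢ ∃∈ L φ
    ∃∈E    : ∀ {Φ L φ ψ} → Φ ⊢ ∃∈ L φ →
             (φ ∷ (hv zero ∈ₕ hwk L) ∷ map wkH Φ) ⊢ wkH ψ → Φ ⊢ ψ
    ∃⊆I    : ∀ {Φ L φ} (K : HTm nh) → Φ ⊢ φ [ K ]ₕ → Φ ⊢ (K ⊆ₕ L) → Φ ⊢ ∃⊆ L φ
    ∃⊆E    : ∀ {Φ L φ ψ} → Φ ⊢ ∃⊆ L φ →
             (φ ∷ (hv zero ⊆ₕ hwk L) ∷ map wkH Φ) ⊢ wkH ψ → Φ ⊢ ψ
    axiom  : ∀ {Φ φ} → Axiom φ → Φ ⊢ φ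

  strongInd : ∀ {ni nh nf} → Form (suc ni) nh nf → Form ni nh nf
  strongInd φ =
    ∀ᵢ (∀ᵢ ((x0 ≺ x1) ⇒ sub (x0 ▸ sh2) hv id φ) ⇒ φ) ⇒ ∀ᵢ φ

-- Let ψ(x) := ∀y (y < x → φ(y)) and let H be the hypothesis ∀x (ψ(x) → φ(x)).
-- Under H, ψ is proved by ordinary induction: ψ(Root) holds vacuously since
-- nothing lies below the root, and since y < S_d(x) ↔ y ≤ x, ψ(S_d(x)) follows
-- from ψ(x) for y < x and from H applied to x for y = x.  Then H turns ∀x ψ(x)
-- into ∀x φ(x).
module Submission where

open import Defs
open import Data.Nat using (ℕ; suc)
open import Data.Fin using (Fin; zero; suc)
open import Data.Vec using (Vec; []; _∷_)
open import Data.List using (List; []; _∷_; map)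
open import Data.List.Membership.Propositional using (_∈_)
open import Data.List.Membership.Propositional.Properties using (∈-allFin)
open import Data.List.Relation.Unary.Any using (here; there)
open import Data.List.Relation.Binary.Subset.Propositional using (_⊆_)
open import Data.List.Relation.Binary.Subset.Propositional.Properties using (map⁺; ∷⁺ʳ)
open import Function using (id; _∘_)
open import Relation.Binary.PropositionalEquality
  using (_≡_; refl; sym; trans; cong; cong₂; subst; _≗_)

module _ {m : ℕ} where
  open FSO m

  tsub-cong : ∀ {a b} {σ σ' : Fin a → Tm b} → σ ≗ σ' → tsub σ ≗ tsub σ'
  tsub-cong e (iv x)  = e x
  tsub-cong e Root    = refl
  tsub-cong e (S d t) = cong (S d) (tsub-cong e t)

  tsub-comp : ∀ {a b c} (σ : Fin b → Tm c) (σ' : Fin a → Tm b) →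
              tsub σ ∘ tsub σ' ≗ tsub (tsub σ ∘ σ')
  tsub-comp σ σ' (iv x)  = refl
  tsub-comp σ σ' Root    = refl
  tsub-comp σ σ' (S d t) = cong (S d) (tsub-comp σ σ' t)

  tsub-id : ∀ {a} → tsub {a} iv ≗ id
  tsub-id (iv x)  = refl
  tsub-id Root    = refl
  tsub-id (S d t) = cong (S d) (tsub-id t)

  tsub-inst-shift : ∀ {a} (t : Tm a) → tsub (t ▸ iv) ∘ tsub (iv ∘ suc) ≗ id
  tsub-inst-shift t u = trans (tsub-comp (t ▸ iv) (iv ∘ suc) u) (tsub-id u)

  mutual
    hsub-cong : ∀ {a b} {τ τ' : Fin a → HTm b} → τ ≗ τ' → hsub τ ≗ hsub τ'
    hsub-cong e (hv k)      = e k
    hsub-cong e (hc κ)      = refl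
    hsub-cong e (hg n k Ks) = cong (hg n k) (hsubs-cong e Ks)

    hsubs-cong : ∀ {a b n} {τ τ' : Fin a → HTm b} → τ ≗ τ' →
                 (Ks : Vec (HTm a) n) → hsubs τ Ks ≡ hsubs τ' Ks
    hsubs-cong e []       = refl
    hsubs-cong e (K ∷ Ks) = cong₂ _∷_ (hsub-cong e K) (hsubs-cong e Ks)

  mutual
    hsub-comp : ∀ {a b c} (τ : Fin b → HTm c) (τ' : Fin a → HTm b) →
                hsub τ ∘ hsub τ' ≗ hsub (hsub τ ∘ τ')
    hsub-comp τ τ' (hv k)      = refl
    hsub-comp τ τ' (hc κ)      = refl
    hsub-comp τ τ' (hg n k Ks) = cong (hg n k) (hsubs-comp τ τ' Ks)

    hsubs-comp : ∀ {a b c n} (τ : Fin b → HTm c) (τ' : Fin a → HTm b) (Ks : Vec (HTm a) n) →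
                 hsubs τ (hsubs τ' Ks) ≡ hsubs (hsub τ ∘ τ') Ks
    hsubs-comp τ τ' []       = refl
    hsubs-comp τ τ' (K ∷ Ks) = cong₂ _∷_ (hsub-comp τ τ' K) (hsubs-comp τ τ' Ks)

  mutual
    hsub-id : ∀ {a} → hsub {a} hv ≗ id
    hsub-id (hv k)      = refl
    hsub-id (hc κ)      = refl
    hsub-id (hg n k Ks) = cong (hg n k) (hsubs-id Ks)

    hsubs-id : ∀ {a n} (Ks : Vec (HTm a) n) → hsubs hv Ks ≡ Ks
    hsubs-id []       = refl
    hsubs-id (K ∷ Ks) = cong₂ _∷_ (hsub-id K) (hsubs-id Ks)

  liftI-cong : ∀ {a b} {σ σ' : Fin a → Tm b} → σ ≗ σ' → liftI σ ≗ liftI σ'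
  liftI-cong e zero    = refl
  liftI-cong e (suc i) = cong (tsub (iv ∘ suc)) (e i)

  liftH-cong : ∀ {a b} {τ τ' : Fin a → HTm b} → τ ≗ τ' → liftH τ ≗ liftH τ'
  liftH-cong e zero    = refl
  liftH-cong e (suc k) = cong (hsub (hv ∘ suc)) (e k)

  liftF-cong : ∀ {a b} {ρ ρ' : Fin a → Fin b} → ρ ≗ ρ' → liftF ρ ≗ liftF ρ'
  liftF-cong e zero    = refl
  liftF-cong e (suc F) = cong suc (e F)

  liftI-comp : ∀ {a b c} (σ : Fin b → Tm c) (σ' : Fin a → Tm b) →
               tsub (liftI σ) ∘ liftI σ' ≗ liftI (tsub σ ∘ σ')
  liftI-comp σ σ' zero    = refl
  liftI-comp σ σ' (suc i) =
    trans (tsub-comp (liftI σ) (iv ∘ suc) (σ' i)) (sym (tsub-comp (iv ∘ suc) σ (σ' i)))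

  liftH-comp : ∀ {a b c} (τ : Fin b → HTm c) (τ' : Fin a → HTm b) →
               hsub (liftH τ) ∘ liftH τ' ≗ liftH (hsub τ ∘ τ')
  liftH-comp τ τ' zero    = refl
  liftH-comp τ τ' (suc k) =
    trans (hsub-comp (liftH τ) (hv ∘ suc) (τ' k)) (sym (hsub-comp (hv ∘ suc) τ (τ' k)))

  sub-cong : ∀ {ni nh nf ni' nh' nf'}
             {σ σ' : Fin ni → Tm ni'} {τ τ' : Fin nh → HTm nh'} {ρ ρ' : Fin nf → Fin nf'} →
             σ ≗ σ' → τ ≗ τ' → ρ ≗ ρ' → sub σ τ ρ ≗ sub σ' τ' ρ'
  sub-cong eσ eτ eρ (t ≐ u)      = cong₂ _≐_ (tsub-cong eσ t) (tsub-cong eσ u)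
  sub-cong eσ eτ eρ (t ≺ u)      = cong₂ _≺_ (tsub-cong eσ t) (tsub-cong eσ u)
  sub-cong eσ eτ eρ (K ≐ₕ L)     = cong₂ _≐ₕ_ (hsub-cong eτ K) (hsub-cong eτ L)
  sub-cong eσ eτ eρ (K ∈ₕ L)     = cong₂ _∈ₕ_ (hsub-cong eτ K) (hsub-cong eτ L)
  sub-cong eσ eτ eρ (K ⊆ₕ L)     = cong₂ _⊆ₕ_ (hsub-cong eτ K) (hsub-cong eτ L)
  sub-cong eσ eτ eρ (app≐ F t K) rewrite eρ F =
    cong₂ (app≐ _) (tsub-cong eσ t) (hsub-cong eτ K)
  sub-cong eσ eτ eρ (φ ∨ ψ)      = cong₂ _∨_ (sub-cong eσ eτ eρ φ) (sub-cong eσ eτ eρ ψ)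
  sub-cong eσ eτ eρ (¬ φ)        = cong ¬_ (sub-cong eσ eτ eρ φ)
  sub-cong eσ eτ eρ (∃ᵢ φ)       = cong ∃ᵢ (sub-cong (liftI-cong eσ) eτ eρ φ)
  sub-cong eσ eτ eρ (∃F∶ K φ)    = cong₂ ∃F∶ (hsub-cong eτ K) (sub-cong eσ eτ (liftF-cong eρ) φ)
  sub-cong eσ eτ eρ (∃∈ L φ)     = cong₂ ∃∈ (hsub-cong eτ L) (sub-cong eσ (liftH-cong eτ) eρ φ)
  sub-cong eσ eτ eρ (∃⊆ L φ)     = cong₂ ∃⊆ (hsub-cong eτ L) (sub-cong eσ (liftH-cong eτ) eρ φ)

  sub-comp : ∀ {n₁ h₁ f₁ n₂ h₂ f₂ n₃ h₃ f₃}
             (σ : Fin n₂ → Tm n₃) (τ : Fin h₂ → HTm h₃) (ρ : Fin f₂ → Fin f₃)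
             (σ' : Fin n₁ → Tm n₂) (τ' : Fin h₁ → HTm h₂) (ρ' : Fin f₁ → Fin f₂) →
             sub σ τ ρ ∘ sub σ' τ' ρ' ≗ sub (tsub σ ∘ σ') (hsub τ ∘ τ') (ρ ∘ ρ')
  sub-comp σ τ ρ σ' τ' ρ' (t ≐ u)      = cong₂ _≐_ (tsub-comp σ σ' t) (tsub-comp σ σ' u)
  sub-comp σ τ ρ σ' τ' ρ' (t ≺ u)      = cong₂ _≺_ (tsub-comp σ σ' t) (tsub-comp σ σ' u)
  sub-comp σ τ ρ σ' τ' ρ' (K ≐ₕ L)     = cong₂ _≐ₕ_ (hsub-comp τ τ' K) (hsub-comp τ τ' L)
  sub-comp σ τ ρ σ' τ' ρ' (K ∈ₕ L)     = cong₂ _∈ₕ_ (hsub-comp τ τ' K) (hsub-comp τ τ' L)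
  sub-comp σ τ ρ σ' τ' ρ' (K ⊆ₕ L)     = cong₂ _⊆ₕ_ (hsub-comp τ τ' K) (hsub-comp τ τ' L)
  sub-comp σ τ ρ σ' τ' ρ' (app≐ F t K) = cong₂ (app≐ _) (tsub-comp σ σ' t) (hsub-comp τ τ' K)
  sub-comp σ τ ρ σ' τ' ρ' (φ ∨ ψ)      =
    cong₂ _∨_ (sub-comp σ τ ρ σ' τ' ρ' φ) (sub-comp σ τ ρ σ' τ' ρ' ψ)
  sub-comp σ τ ρ σ' τ' ρ' (¬ φ)        = cong ¬_ (sub-comp σ τ ρ σ' τ' ρ' φ)
  sub-comp σ τ ρ σ' τ' ρ' (∃ᵢ φ)       = cong ∃ᵢ (trans
    (sub-comp (liftI σ) τ ρ (liftI σ') τ' ρ' φ)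
    (sub-cong (liftI-comp σ σ') (λ _ → refl) (λ _ → refl) φ))
  sub-comp σ τ ρ σ' τ' ρ' (∃F∶ K φ)    = cong₂ ∃F∶ (hsub-comp τ τ' K) (trans
    (sub-comp σ τ (liftF ρ) σ' τ' (liftF ρ') φ)
    (sub-cong (λ _ → refl) (λ _ → refl) (λ { zero → refl ; (suc _) → refl }) φ))
  sub-comp σ τ ρ σ' τ' ρ' (∃∈ L φ)     = cong₂ ∃∈ (hsub-comp τ τ' L) (trans
    (sub-comp σ (liftH τ) ρ σ' (liftH τ') ρ' φ)
    (sub-cong (λ _ → refl) (liftH-comp τ τ') (λ _ → refl) φ))
  sub-comp σ τ ρ σ' τ' ρ' (∃⊆ L φ)     = cong₂ ∃⊆ (hsub-comp τ τ' L) (trans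
    (sub-comp σ (liftH τ) ρ σ' (liftH τ') ρ' φ)
    (sub-cong (λ _ → refl) (liftH-comp τ τ') (λ _ → refl) φ))

  sub-id : ∀ {ni nh nf} → sub {ni} {nh} {nf} iv hv id ≗ id
  sub-id (t ≐ u)      = cong₂ _≐_ (tsub-id t) (tsub-id u)
  sub-id (t ≺ u)      = cong₂ _≺_ (tsub-id t) (tsub-id u)
  sub-id (K ≐ₕ L)     = cong₂ _≐ₕ_ (hsub-id K) (hsub-id L)
  sub-id (K ∈ₕ L)     = cong₂ _∈ₕ_ (hsub-id K) (hsub-id L)
  sub-id (K ⊆ₕ L)     = cong₂ _⊆ₕ_ (hsub-id K) (hsub-id L)
  sub-id (app≐ F t K) = cong₂ (app≐ F) (tsub-id t) (hsub-id K)
  sub-id (φ ∨ ψ)      = cong₂ _∨_ (sub-id φ) (sub-id ψ)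
  sub-id (¬ φ)        = cong ¬_ (sub-id φ)
  sub-id (∃ᵢ φ)       = cong ∃ᵢ
    (trans (sub-cong (λ { zero → refl ; (suc _) → refl }) (λ _ → refl) (λ _ → refl) φ) (sub-id φ))
  sub-id (∃F∶ K φ)    = cong₂ ∃F∶ (hsub-id K)
    (trans (sub-cong (λ _ → refl) (λ _ → refl) (λ { zero → refl ; (suc _) → refl }) φ) (sub-id φ))
  sub-id (∃∈ L φ)     = cong₂ ∃∈ (hsub-id L)
    (trans (sub-cong (λ _ → refl) (λ { zero → refl ; (suc _) → refl }) (λ _ → refl) φ) (sub-id φ))
  sub-id (∃⊆ L φ)     = cong₂ ∃⊆ (hsub-id L)
    (trans (sub-cong (λ _ → refl) (λ { zero → refl ; (suc _) → refl }) (λ _ → refl) φ) (sub-id φ))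

  sub-fuse : ∀ {a b c nh nf} (σ : Fin b → Tm c) (σ' : Fin a → Tm b) {σ'' : Fin a → Tm c} →
             tsub σ ∘ σ' ≗ σ'' → sub {nh = nh} {nf = nf} σ hv id ∘ sub σ' hv id ≗ sub σ'' hv id
  sub-fuse σ σ' e φ = trans (sub-comp σ hv id σ' hv id φ) (sub-cong e (λ _ → refl) (λ _ → refl) φ)

  liftI-inst : ∀ {a b nh nf} (t : Tm b) (ρ : Fin a → Tm b) (φ : Form (suc a) nh nf) →
               sub (liftI ρ) hv id φ [ t ]ᵢ ≡ sub (t ▸ ρ) hv id φ
  liftI-inst t ρ =
    sub-fuse (t ▸ iv) (liftI ρ) (λ { zero → refl ; (suc j) → tsub-inst-shift t (ρ j) })

  wkI-lift-inst-fresh : ∀ {ni nh nf} (φ : Form (suc ni) nh nf) →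
                        sub (liftI (iv ∘ suc)) hv id φ [ x0 ]ᵢ ≡ φ
  wkI-lift-inst-fresh φ = trans (liftI-inst x0 (iv ∘ suc) φ)
    (trans (sub-cong (λ { zero → refl ; (suc _) → refl }) (λ _ → refl) (λ _ → refl) φ) (sub-id φ))

  sub-⋀ : ∀ {A : Set} {ni nh nf ni' nh' nf'}
          (σ : Fin ni → Tm ni') (τ : Fin nh → HTm nh') (ρ : Fin nf → Fin nf')
          (f : A → Form ni nh nf) (xs : List A) →
          sub σ τ ρ (⋀ (map f xs)) ≡ ⋀ (map (sub σ τ ρ ∘ f) xs)
  sub-⋀ σ τ ρ f []           = refl
  sub-⋀ σ τ ρ f (x ∷ [])     = refl
  sub-⋀ σ τ ρ f (x ∷ y ∷ ys) = cong (sub σ τ ρ (f x) ∧_) (sub-⋀ σ τ ρ f (y ∷ ys))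

  weaken : ∀ {ni nh nf} {Φ Ψ : List (Form ni nh nf)} {φ} → Φ ⊆ Ψ → Φ ⊢ φ → Ψ ⊢ φ
  weaken s exm           = exm
  weaken s (ass p)       = ass (s p)
  weaken s (exfalso D E) = exfalso (weaken s D) (weaken s E)
  weaken s (∨Iˡ D)       = ∨Iˡ (weaken s D)
  weaken s (∨Iʳ D)       = ∨Iʳ (weaken s D)
  weaken s (∨E D E F)    = ∨E (weaken s D) (weaken (∷⁺ʳ _ s) E) (weaken (∷⁺ʳ _ s) F)
  weaken s (∃ᵢI t D)     = ∃ᵢI t (weaken s D)
  weaken s (∃ᵢE D E)     = ∃ᵢE (weaken s D) (weaken (∷⁺ʳ _ (map⁺ wkI s)) E)
  weaken s (∃FI G D E)   = ∃FI G (weaken s D) (weaken s E)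
  weaken s (∃FE D E)     = ∃FE (weaken s D) (weaken (∷⁺ʳ _ (∷⁺ʳ _ (map⁺ wkF s))) E)
  weaken s (∃∈I K D E)   = ∃∈I K (weaken s D) (weaken s E)
  weaken s (∃∈E D E)     = ∃∈E (weaken s D) (weaken (∷⁺ʳ _ (∷⁺ʳ _ (map⁺ wkH s))) E)
  weaken s (∃⊆I K D E)   = ∃⊆I K (weaken s D) (weaken s E)
  weaken s (∃⊆E D E)     = ∃⊆E (weaken s D) (weaken (∷⁺ʳ _ (∷⁺ʳ _ (map⁺ wkH s))) E)
  weaken s (axiom a)     = axiom a

  weaken₁ : ∀ {ni nh nf} {Γ : List (Form ni nh nf)} {φ ψ} → Γ ⊢ φ → (ψ ∷ Γ) ⊢ φ
  weaken₁ = weaken there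

  module _ {ni nh nf : ℕ} {Γ : List (Form ni nh nf)} where

    -- ∀I shifts the whole context and derivations admit no substitution here,
    -- so rules that use ∀I are derived in the empty context and moved to Γ by this.
    weaken-closed : ∀ {φ} → [] ⊢ φ → Γ ⊢ φ
    weaken-closed = weaken λ ()

    ⇒I : ∀ {φ ψ} → (φ ∷ Γ) ⊢ ψ → Γ ⊢ φ ⇒ ψ
    ⇒I D = ∨E exm (∨Iʳ D) (∨Iˡ (ass (here refl)))

    ⇒E : ∀ {φ ψ} → Γ ⊢ φ ⇒ ψ → Γ ⊢ φ → Γ ⊢ ψ
    ⇒E D E = ∨E D (exfalso (weaken₁ E) (ass (here refl))) (ass (here refl))

    ∧I : ∀ {φ ψ} → Γ ⊢ φ → Γ ⊢ ψ → Γ ⊢ φ ∧ ψ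
    ∧I D E = ∨E exm
      (∨E (ass (here refl)) (exfalso (weaken₁ (weaken₁ D)) (ass (here refl)))
                            (exfalso (weaken₁ (weaken₁ E)) (ass (here refl))))
      (ass (here refl))

    ∧E₁ : ∀ {φ ψ} → Γ ⊢ φ ∧ ψ → Γ ⊢ φ
    ∧E₁ D = ∨E exm (ass (here refl)) (exfalso (∨Iˡ (ass (here refl))) (weaken₁ D))

    ∧E₂ : ∀ {φ ψ} → Γ ⊢ φ ∧ ψ → Γ ⊢ ψ
    ∧E₂ D = ∨E exm (ass (here refl)) (exfalso (∨Iʳ (ass (here refl))) (weaken₁ D))

    ∀I : ∀ {φ} → map wkI Γ ⊢ φ → Γ ⊢ ∀ᵢ φ
    ∀I D = ∨E exm
      (∃ᵢE (ass (here refl)) (exfalso (weaken (there ∘ there) D) (ass (here refl))))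
      (ass (here refl))

    ∀E : ∀ {φ} → Γ ⊢ ∀ᵢ φ → (t : Tm ni) → Γ ⊢ φ [ t ]ᵢ
    ∀E {φ} D t =
      ∨E exm (ass (here refl)) (exfalso (∃ᵢI {φ = ¬ φ} t (ass (here refl))) (weaken₁ D))

    ∀E₂ : ∀ {φ} → Γ ⊢ ∀ᵢ (∀ᵢ φ) → (t u : Tm ni) → Γ ⊢ sub (u ▸ (t ▸ iv)) hv id φ
    ∀E₂ {φ} D t u = subst (Γ ⊢_) (liftI-inst u (t ▸ iv) φ) (∀E (∀E D t) u)

    ∀E₃ : ∀ {φ} → Γ ⊢ ∀ᵢ (∀ᵢ (∀ᵢ φ)) → (t u v : Tm ni) →
          Γ ⊢ sub (v ▸ (u ▸ (t ▸ iv))) hv id φ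
    ∀E₃ {φ} D t u v = subst (Γ ⊢_) (liftI-inst v (u ▸ (t ▸ iv)) φ) (∀E (∀E₂ D t u) v)

    ⋀I : ∀ {A : Set} (f : A → Form ni nh nf) (xs : List A) →
         (∀ x → Γ ⊢ f x) → Γ ⊢ ⋀ (map f xs)
    ⋀I f []           D = ∀E (axiom eqRefl) Root
    ⋀I f (x ∷ [])     D = D x
    ⋀I f (x ∷ y ∷ ys) D = ∧I (D x) (⋀I f (y ∷ ys) D)

    ⋀E : ∀ {A : Set} (f : A → Form ni nh nf) (xs : List A) {x} →
         Γ ⊢ ⋀ (map f xs) → x ∈ xs → Γ ⊢ f x
    ⋀E f (x ∷ [])     D (here refl) = D
    ⋀E f (x ∷ y ∷ ys) D (here refl) = ∧E₁ D
    ⋀E f (x ∷ y ∷ ys) D (there p)   = ⋀E f (y ∷ ys) (∧E₂ D) p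

  ∀E-fresh : ∀ {ni nh nf} {Γ : List (Form (suc ni) nh nf)} {φ} → Γ ⊢ wkI (∀ᵢ φ) → Γ ⊢ φ
  ∀E-fresh {Γ = Γ} {φ} D = subst (Γ ⊢_) (wkI-lift-inst-fresh φ) (∀E D x0)

  ∀-⇒-distrib : ∀ {ni nh nf} {φ ψ : Form (suc ni) nh nf} → [] ⊢ ∀ᵢ (φ ⇒ ψ) ⇒ ∀ᵢ φ ⇒ ∀ᵢ ψ
  ∀-⇒-distrib =
    ⇒I (⇒I (∀I (⇒E (∀E-fresh (ass (there (here refl)))) (∀E-fresh (ass (here refl))))))

  ∀-⇒E : ∀ {ni nh nf} {Γ : List (Form ni nh nf)} {φ ψ} →
         Γ ⊢ ∀ᵢ (φ ⇒ ψ) → Γ ⊢ ∀ᵢ φ → Γ ⊢ ∀ᵢ ψ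
  ∀-⇒E D E = ⇒E (⇒E (weaken-closed ∀-⇒-distrib) D) E

  ≐-refl : ∀ {ni nh nf} {Γ : List (Form ni nh nf)} (t : Tm ni) → Γ ⊢ t ≐ t
  ≐-refl t = ∀E (axiom eqRefl) t

  ≐-subst : ∀ {ni nh nf k} {Γ : List (Form ni nh nf)}
            (φ : Form (suc k) nh nf) (ρ : Fin k → Tm ni) {t u : Tm ni} →
            Γ ⊢ t ≐ u → Γ ⊢ sub (t ▸ ρ) hv id φ → Γ ⊢ sub (u ▸ ρ) hv id φ
  ≐-subst {ni} {nh} {nf} {Γ = Γ} φ ρ {t} {u} t≐u D =
    ⇒E (⇒E (subst (Γ ⊢_) (cong₂ (λ A B → (t ≐ u) ⇒ A ⇒ B) (inst x1) (inst x0)) leibniz) t≐u) D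
    where
    χ : Form (suc ni) nh nf
    χ = sub (liftI ρ) hv id φ
    leibniz : Γ ⊢ sub (u ▸ (t ▸ iv)) hv id
                    ((x1 ≐ x0) ⇒ sub (x1 ▸ sh2) hv id χ ⇒ sub (x0 ▸ sh2) hv id χ)
    leibniz = ∀E₂ (axiom (eqLeib χ)) t u
    inst : (s : Tm (suc (suc ni))) →
           sub (u ▸ (t ▸ iv)) hv id (sub (s ▸ sh2) hv id χ)
             ≡ sub (tsub (u ▸ (t ▸ iv)) s ▸ ρ) hv id φ
    inst s = trans (sub-fuse (u ▸ (t ▸ iv)) (s ▸ sh2) (λ { zero → refl ; (suc _) → refl }) χ)
                   (liftI-inst (tsub (u ▸ (t ▸ iv)) s) ρ φ)

  ≐-sym : ∀ {ni nh nf} {Γ : List (Form ni nh nf)} {t u : Tm ni} → Γ ⊢ t ≐ u → Γ ⊢ u ≐ t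
  ≐-sym {t = t} t≐u = ≐-subst (x0 ≐ x1) (t ▸ iv) t≐u (≐-refl t)

  ≺-Root-elim : ∀ {ni nh nf} {Γ : List (Form ni nh nf)} {t : Tm ni} {χ} → Γ ⊢ t ≺ Root → Γ ⊢ χ
  ≺-Root-elim {Γ = Γ} {t} t≺Root = exfalso (∃ᵢI {φ = x0 ≺ x0} t t≺t) (axiom tree3)
    where
    t≺t : Γ ⊢ t ≺ t
    t≺t = ∨E (∀E (axiom tree5) t)
      (⇒E (⇒E (∀E₃ (axiom tree4) t Root t) (weaken₁ t≺Root)) (ass (here refl)))
      (≐-subst (x1 ≺ x0) (t ▸ iv) (ass (here refl)) (weaken₁ t≺Root))

  ≺-S-inv : ∀ {ni nh nf} {Γ : List (Form ni nh nf)} {t u : Tm ni} (d : Dir) →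
            Γ ⊢ t ≺ S d u → Γ ⊢ t ≼ u
  ≺-S-inv {Γ = Γ} {t} {u} d t≺Su = ⇒E (∧E₁ (⋀E _ dirs tree6-at (∈-allFin d))) t≺Su
    where
    tree6-at : Γ ⊢ ⋀ (map (λ d' → (t ≺ S d' u) ⇔ (t ≼ u)) dirs)
    tree6-at = subst (Γ ⊢_) (sub-⋀ (u ▸ (t ▸ iv)) hv id _ dirs) (∀E₂ (axiom tree6) t u)

  allBelow : ∀ {ni nh nf} → Form (suc ni) nh nf → Form (suc ni) nh nf
  allBelow φ = ∀ᵢ ((x0 ≺ x1) ⇒ sub (x0 ▸ sh2) hv id φ)

  progressive : ∀ {ni nh nf} → Form (suc ni) nh nf → Form ni nh nf
  progressive φ = ∀ᵢ (allBelow φ ⇒ φ)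

  allBelow-Root : ∀ {ni nh nf} {Γ : List (Form ni nh nf)} (φ : Form (suc ni) nh nf) →
                  Γ ⊢ allBelow φ [ Root ]ᵢ
  allBelow-Root φ = ∀I (⇒I (≺-Root-elim (ass (here refl))))

  allBelow-S : ∀ {ni nh nf} (φ : Form (suc ni) nh nf) (d : Dir) →
               [] ⊢ (allBelow φ ⇒ φ) ⇒ allBelow φ ⇒ sub (S d x0 ▸ sh1) hv id (allBelow φ)
  allBelow-S {ni} {nh} {nf} φ d =
    ⇒I (⇒I (subst (allBelow φ ∷ (allBelow φ ⇒ φ) ∷ [] ⊢_)
                  (cong (λ A → ∀ᵢ ((x0 ≺ S d x1) ⇒ A)) (sym below-S-shift))
                  (∀I (⇒I (∨E (≺-S-inv d (ass (here refl))) y<x y≐x)))))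
    where
    φy : Form (suc (suc ni)) nh nf
    φy = sub (x0 ▸ sh2) hv id φ
    below-S-shift : sub (liftI (S d x0 ▸ sh1)) hv id φy ≡ φy
    below-S-shift =
      sub-fuse (liftI (S d x0 ▸ sh1)) (x0 ▸ sh2) (λ { zero → refl ; (suc _) → refl }) φ
    Δ : List (Form (suc (suc ni)) nh nf)
    Δ = (x0 ≺ S d x1) ∷ wkI (allBelow φ) ∷ wkI (allBelow φ ⇒ φ) ∷ []
    y<x : ((x0 ≺ x1) ∷ Δ) ⊢ φy
    y<x = ⇒E (∀E-fresh (ass (there (there (here refl))))) (ass (here refl))
    φx : ((x0 ≐ x1) ∷ Δ) ⊢ sub (x1 ▸ sh2) hv id φ
    φx = subst ((x0 ≐ x1) ∷ Δ ⊢_)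
               (sub-cong (λ { zero → refl ; (suc _) → refl }) (λ _ → refl) (λ _ → refl) φ)
               (⇒E (ass (there (there (there (here refl))))) (ass (there (there (here refl)))))
    y≐x : ((x0 ≐ x1) ∷ Δ) ⊢ φy
    y≐x = ≐-subst φ sh2 (≐-sym (ass (here refl))) φx

  progressive⇒∀allBelow : ∀ {ni nh nf} (φ : Form (suc ni) nh nf) →
                          (progressive φ ∷ []) ⊢ ∀ᵢ (allBelow φ)
  progressive⇒∀allBelow φ = ⇒E (⇒E (axiom (induction (allBelow φ))) (allBelow-Root φ))
    (⋀I _ dirs λ d → ∀I (⇒E (weaken-closed (allBelow-S φ d)) (∀E-fresh (ass (here refl)))))

theorem3p9 : (m : ℕ) {ni nh nf : ℕ} (φ : FSO.Form m (suc ni) nh nf) →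
    FSO._⊢_ m [] (FSO.strongInd m φ)
theorem3p9 m φ = ⇒I (∀-⇒E (FSO.ass (here refl)) (progressive⇒∀allBelow φ))
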